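{- Let $G=(V,E)$ be a directed, connected, acyclic graph without parallel arcs with $n=|V|$ nodes, let $\mathcal{C}=\{1,\dots,K\}$ with $K$ fixed, let $f\colon E\to\mathcal{C}$ and $s\in V$. Then for every $v\in V$, the number of distinct sorted ordinal path vectors $\mathrm{sort}(f(P))$, where $P$ ranges over the directed $s$-$v$-paths, is $\mathcal{O}(n^K)$.
   Context: For a directed path $P$ with arcs $e_1,\dots,e_k$, its ordinal path vector is $f(P)=(f(e_1),\dots,f(e_k))$, and $\mathrm{sort}(f(P))$ is this vector rearranged in non-decreasing order with respect to $1\prec2\prec\cdots\prec K$. -}

module Defs where

open import Data.Nat using (ℕ; zero; suc)
open import Data.Fin using (Fin)
open import Data.Fin.Properties using (≤-decTotalOrder)
open import Data.Bool using (Bool; true)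
open import Data.List using (List; []; _∷_)
open import Data.Empty using (⊥)
open import Data.Product using (∃-syntax)
open import Relation.Binary.PropositionalEquality using (_≡_)
import Data.List.Sort as Sort
open import Data.List.Relation.Unary.Unique.Propositional using (Unique)

-- A simple digraph on vertex set V = Fin n, given by a Boolean adjacency
-- matrix: there is an arc u → w iff adj u w ≡ true. This representation
-- automatically excludes parallel arcs.
Digraph : ℕ → Set
Digraph n = Fin n → Fin n → Bool

Arc : ∀ {n} → Digraph n → Fin n → Fin n → Set
Arc G u w = G u w ≡ true

data Walk {n} (G : Digraph n) : Fin n → Fin n → Set where
  []  : ∀ {u} → Walk G u u
  _∷_ : ∀ {u w x} → Arc G u w → Walk G w x → Walk G u x

vertices : ∀ {n} {G : Digraph n} {u w} → Walk G u w → List (Fin n)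
vertices {u = u} []       = u ∷ []
vertices {u = u} (_ ∷ p)  = u ∷ vertices p

IsPath : ∀ {n} {G : Digraph n} {u w} → Walk G u w → Set
IsPath p = Unique (vertices p)

Acyclic : ∀ {n} → Digraph n → Set
Acyclic G = ∀ u w → Arc G u w → Walk G w u → ⊥

data UWalk {n} (G : Digraph n) : Fin n → Fin n → Set where
  []   : ∀ {u} → UWalk G u u
  fwd  : ∀ {u w x} → Arc G u w → UWalk G w x → UWalk G u x
  bwd  : ∀ {u w x} → Arc G w u → UWalk G w x → UWalk G u x

-- Connected (weakly connected, the usual notion for digraphs).
Connected : ∀ {n} → Digraph n → Set
Connected G = ∀ u w → UWalk G u w

-- An arc colouring f : E → C, with C = {1,…,K} represented by Fin K
-- (colour i+1 ↦ i), ordered by the usual order of Fin K.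
Colouring : ∀ {n} → Digraph n → ℕ → Set
Colouring G K = ∀ u w → Arc G u w → Fin K

pathVector : ∀ {n K} {G : Digraph n} → Colouring G K → ∀ {u w} → Walk G u w → List (Fin K)
pathVector f []                     = []
pathVector f (_∷_ {u} {w} a p)      = f u w a ∷ pathVector f p

sortVec : ∀ {K} → List (Fin K) → List (Fin K)
sortVec {K} = Sort.sort (≤-decTotalOrder K)

Realised : ∀ {n K} (G : Digraph n) → Colouring G K → Fin n → Fin n → List (Fin K) → Set
Realised G f s v σ = ∃[ p ] (IsPath {G = G} {s} {v} p × sortVec (pathVector f p) ≡ σ)
  where open import Data.Product using (_×_)

module Submission where

-- The bound holds with c = 1.  A directed s-v path visits pairwise distinct
-- vertices, so it has at most n vertices and hence fewer than n arcs; every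
-- sorted ordinal path vector σ is therefore a sorted list of length < n.
-- A sorted list is determined by its colour profile x ↦ (multiplicity of
-- x in σ), and for such short lists the profile is a function
-- Fin K → Fin n, of which there are n ^ K, encoded injectively in
-- Fin (n ^ K) by the library map funToFin.  A pigeonhole principle for
-- duplicate-free lists then bounds the number of distinct vectors by n ^ K.

open import Defs
open import Data.Nat using (ℕ; _≤_; _*_; _^_)
open import Data.Fin using (Fin)
open import Data.List using (List; length)
open import Data.Product using (∃-syntax)
open import Data.List.Relation.Unary.All using (All)
open import Data.List.Relation.Unary.Unique.Propositional using (Unique)

open import Data.Nat using (suc; _<_; z≤n; s≤s)
open import Data.Nat.Properties
  using (m≤n⇒m≤1+n; ≤-<-trans; <-≤-trans; <-irrefl; suc-injective; 0≢1+n; *-identityˡ)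
open import Data.Fin as F using (toℕ; fromℕ<; funToFin; finToFun)
open import Data.Fin.Properties as FP
  using (_≟_; <-cmp; injective⇒≤; toℕ-fromℕ<; finToFun-funToFin; ≤-decTotalOrder)
open import Data.List as L using ([]; _∷_)
open import Data.List.Relation.Unary.All as All using ([]; _∷_)
open import Data.List.Relation.Unary.AllPairs using (AllPairs; []; _∷_)
open import Data.List.Relation.Unary.Linked.Properties using (Linked⇒AllPairs)
open import Data.List.Membership.Propositional.Properties using (∈-lookup)
open import Data.List.Relation.Binary.Permutation.Propositional.Properties using (↭-length)
open import Data.List.Sort using (sort-↗; sort-↭)
open import Data.Product using (_,_; _×_)
open import Data.Empty using (⊥-elim)
open import Data.Unit using (⊤; tt)
open import Relation.Nullary using (yes; no)
open import Relation.Binary.PropositionalEquality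
  using (_≡_; refl; sym; trans; cong; subst; module ≡-Reasoning)
open import Relation.Binary.Definitions using (tri<; tri≈; tri>)

lookup-injective : ∀ {a} {X : Set a} {xs : List X} → Unique xs →
                   ∀ {i j} → L.lookup xs i ≡ L.lookup xs j → i ≡ j
lookup-injective (_ ∷ _)       {F.zero}  {F.zero}  _ = refl
lookup-injective (x∉xs ∷ _)    {F.zero}  {F.suc j} e = ⊥-elim (All.lookup x∉xs (∈-lookup j) e)
lookup-injective (x∉xs ∷ _)    {F.suc i} {F.zero}  e = ⊥-elim (All.lookup x∉xs (∈-lookup i) (sym e))
lookup-injective (_ ∷ unique)  {F.suc i} {F.suc j} e = cong F.suc (lookup-injective unique e)

-- If the entries of a duplicate-free list satisfy P, and elements
-- satisfying P can be coded injectively into Fin m, the list has at most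
-- m entries: its positions inject into Fin m.
coded-unique⇒length≤ : ∀ {a p m} {X : Set a} {P : X → Set p} {xs : List X}
  (code : ∀ {x} → P x → Fin m) →
  (∀ {x y} (px : P x) (py : P y) → code px ≡ code py → x ≡ y) →
  Unique xs → All P xs → length xs ≤ m
coded-unique⇒length≤ {P = P} {xs = xs} code code-injective unique pxs =
  injective⇒≤ (λ {i} {j} e → lookup-injective unique (code-injective (entry i) (entry j) e))
  where
  entry : ∀ i → P (L.lookup xs i)
  entry i = All.lookup pxs (∈-lookup i)

unique⇒length≤ : ∀ {m} {xs : List (Fin m)} → Unique xs → length xs ≤ m
unique⇒length≤ {xs = xs} unique =
  coded-unique⇒length≤ {P = λ _ → ⊤} (λ {x} _ → x) (λ _ _ e → e) unique (All.universal (λ _ → tt) xs)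

multiplicity : ∀ {K} → Fin K → List (Fin K) → ℕ
multiplicity x []       = 0
multiplicity x (y ∷ ys) with x ≟ y
... | yes _ = suc (multiplicity x ys)
... | no  _ = multiplicity x ys

multiplicity≤length : ∀ {K} (x : Fin K) ys → multiplicity x ys ≤ length ys
multiplicity≤length x []       = z≤n
multiplicity≤length x (y ∷ ys) with x ≟ y
... | yes _ = s≤s (multiplicity≤length x ys)
... | no  _ = m≤n⇒m≤1+n (multiplicity≤length x ys)

multiplicity-head : ∀ {K} (x : Fin K) ys → multiplicity x (x ∷ ys) ≡ suc (multiplicity x ys)
multiplicity-head x ys with x ≟ x
... | yes _  = refl
... | no x≢x = ⊥-elim (x≢x refl)

multiplicity-below : ∀ {K} (x : Fin K) ys → All (x F.<_) ys → multiplicity x ys ≡ 0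
multiplicity-below x []       []         = refl
multiplicity-below x (y ∷ ys) (x<y ∷ xs<) with x ≟ y
... | yes refl = ⊥-elim (<-irrefl refl x<y)
... | no  _    = multiplicity-below x ys xs<

multiplicity-cancel : ∀ {K} (a x : Fin K) ys zs →
  multiplicity x (a ∷ ys) ≡ multiplicity x (a ∷ zs) → multiplicity x ys ≡ multiplicity x zs
multiplicity-cancel a x ys zs e with x ≟ a
... | yes _ = suc-injective e
... | no  _ = e

Sorted : ∀ {K} → List (Fin K) → Set
Sorted = AllPairs F._≤_

-- The head of a sorted list (a ∷ σ) is ≤ all of σ, so the head of the
-- other list being smaller would make it missing from (a ∷ σ).
head-missing : ∀ {K} {a b : Fin K} (σ : List (Fin K)) → b F.< a → All (a F.≤_) σ →
               multiplicity b (a ∷ σ) ≡ 0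
head-missing σ b<a a≤σ = multiplicity-below _ (_ ∷ σ) (b<a ∷ All.map (<-≤-trans b<a) a≤σ)

sorted-multiplicity-injective : ∀ {K} {σ τ : List (Fin K)} → Sorted σ → Sorted τ →
  (∀ x → multiplicity x σ ≡ multiplicity x τ) → σ ≡ τ
sorted-multiplicity-injective {σ = []}    {[]}    _ _ _ = refl
sorted-multiplicity-injective {σ = []}    {b ∷ τ} _ _ e =
  ⊥-elim (0≢1+n (trans (e b) (multiplicity-head b τ)))
sorted-multiplicity-injective {σ = a ∷ σ} {[]}    _ _ e =
  ⊥-elim (0≢1+n (trans (sym (e a)) (multiplicity-head a σ)))
sorted-multiplicity-injective {σ = a ∷ σ} {b ∷ τ} (a≤σ ∷ σ↗) (b≤τ ∷ τ↗) e with <-cmp a b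
... | tri≈ _ refl _ =
  cong (a ∷_) (sorted-multiplicity-injective σ↗ τ↗ (λ x → multiplicity-cancel a x σ τ (e x)))
... | tri< a<b _ _ =
  ⊥-elim (0≢1+n (trans (sym (head-missing τ a<b b≤τ)) (trans (sym (e a)) (multiplicity-head a σ))))
... | tri> _ _ b<a =
  ⊥-elim (0≢1+n (trans (sym (head-missing σ b<a a≤σ)) (trans (e b) (multiplicity-head b τ))))

ShortSorted : ℕ → ∀ {K} → List (Fin K) → Set
ShortSorted n σ = Sorted σ × length σ < n

-- Every multiplicity of a short list is below n, so the colour profile is
-- a function Fin K → Fin n.
profile : ∀ {n K} {σ : List (Fin K)} → ShortSorted n σ → Fin K → Fin n
profile {σ = σ} (_ , short) x = fromℕ< (≤-<-trans (multiplicity≤length x σ) short)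

profile-multiplicity : ∀ {n K} {σ : List (Fin K)} (sσ : ShortSorted n σ) x →
                       toℕ (profile sσ x) ≡ multiplicity x σ
profile-multiplicity (_ , short) x = toℕ-fromℕ< _

profileCode : ∀ {n K} {σ : List (Fin K)} → ShortSorted n σ → Fin (n ^ K)
profileCode sσ = funToFin (profile sσ)

profileCode-injective : ∀ {n K} {σ τ : List (Fin K)} (sσ : ShortSorted n σ) (sτ : ShortSorted n τ) →
                        profileCode sσ ≡ profileCode sτ → σ ≡ τ
profileCode-injective {σ = σ} {τ} sσ@(σ↗ , _) sτ@(τ↗ , _) e =
  sorted-multiplicity-injective σ↗ τ↗ same-multiplicity
  where
  open ≡-Reasoning
  same-multiplicity : ∀ x → multiplicity x σ ≡ multiplicity x τ
  same-multiplicity x = begin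
    multiplicity x σ                           ≡⟨ sym (profile-multiplicity sσ x) ⟩
    toℕ (profile sσ x)                         ≡⟨ cong toℕ (sym (finToFun-funToFin (profile sσ) x)) ⟩
    toℕ (finToFun (profileCode sσ) x)          ≡⟨ cong (λ c → toℕ (finToFun c x)) e ⟩
    toℕ (finToFun (profileCode sτ) x)          ≡⟨ cong toℕ (finToFun-funToFin (profile sτ) x) ⟩
    toℕ (profile sτ x)                         ≡⟨ profile-multiplicity sτ x ⟩
    multiplicity x τ                           ∎

vertices-length : ∀ {n K} {G : Digraph n} (f : Colouring G K) {u w} (p : Walk G u w) →
                  length (vertices p) ≡ suc (length (pathVector f p))
vertices-length f []      = refl
vertices-length f (_ ∷ p) = cong suc (vertices-length f p)

path-short : ∀ {n K} {G : Digraph n} (f : Colouring G K) {u w} (p : Walk G u w) →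
             IsPath p → length (pathVector f p) < n
path-short f p isPath = subst (_≤ _) (vertices-length f p) (unique⇒length≤ isPath)

realised⇒shortSorted : ∀ {n K} {G : Digraph n} (f : Colouring G K) {s v} {σ : List (Fin K)} →
                       Realised G f s v σ → ShortSorted n σ
realised⇒shortSorted {n} {K} f (p , isPath , refl) =
  ( Linked⇒AllPairs FP.≤-trans (sort-↗ (≤-decTotalOrder K) (pathVector f p))
  , subst (_< n) (sym (↭-length (sort-↭ (≤-decTotalOrder K) (pathVector f p)))) (path-short f p isPath))

mainTheorem3 : (K : ℕ) → ∃[ c ] ((n : ℕ) (G : Digraph n) → Acyclic G → Connected G →
                 (f : Colouring G K) (s v : Fin n) (L : List (List (Fin K))) →
                 Unique L → All (Realised G f s v) L → length L ≤ c * n ^ K)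
mainTheorem3 K = 1 , λ n G _ _ f s v L unique realised →
  subst (length L ≤_) (sym (*-identityˡ (n ^ K)))
    (coded-unique⇒length≤ profileCode profileCode-injective unique
      (All.map (realised⇒shortSorted f) realised))
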